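{- Let $f:\{0,1\}^n\to\{0,1\}$ be monotone, let $j\in[n]$, and let $f_0,f_1$ be the functions on the variables $[n]\setminus\{j\}$ obtained from $f$ by setting $x_j=0$, respectively $x_j=1$ (the two subfunctions at the root of a decision tree for $f$ querying $x_j$ first). If neither $f_0$ nor $f_1$ is constant, then \[ C^0_{\min}(f_0)+C^1_{\min}(f_1)\le |R(f_0)\cap R(f_1)|+1. \]
   Context: $f$ is monotone if $x\le y$ coordinatewise implies $f(x)\le f(y)$. $R(g)$ is the set of relevant coordinates of $g$ (those $i$ with $g(x)\ne g(x^i)$ for some $x$, $x^i$ being $x$ with bit $i$ flipped). $C_x(g)$ is the smallest size of a set $S$ of coordinates such that $g$ is constant on $\{y: y_i=x_i\ \forall i\in S\}$. $C^0_{\min}(g):=\min_{x: g(x)=0}C_x(g)$ and $C^1_{\min}(g):=\min_{x:g(x)=1}C_x(g)$. -}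

module Defs where

open import Data.Bool.Base using (Bool; true; false; not; _∧_; _∨_; if_then_else_; _≤_)
open import Data.Bool.Properties using (_≟_)
open import Data.Nat.Base using (ℕ; zero; suc; _⊓_)
open import Data.Fin.Base using (Fin)
open import Data.List.Base using (List; []; _∷_; [_]; concatMap; allFin; filter; length; foldr)
open import Data.Bool.ListAction using (all; any)
open import Data.Vec.Functional using (Vector; insertAt; updateAt) renaming (_∷_ to _∷ᵥ_)
open import Relation.Binary.PropositionalEquality using (_≡_)
open import Relation.Nullary.Decidable using (⌊_⌋)

Cube : ℕ → Set
Cube n = Vector Bool n

BoolFun : ℕ → Set
BoolFun n = Cube n → Bool

Monotone : ∀ {n} → BoolFun n → Set
Monotone {n} f = ∀ (x y : Cube n) → (∀ i → x i ≤ y i) → f x ≤ f y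

-- Subfunction obtained by setting x_j := b; it is a function of the remaining
-- n-1 variables [n] \ {j}, indexed by Fin m (inserted around position j).
restrict : ∀ {m} → BoolFun (suc m) → Fin (suc m) → Bool → BoolFun m
restrict f j b y = f (insertAt y j b)

IsConstant : ∀ {n} → BoolFun n → Set
IsConstant {n} g = ∀ (x y : Cube n) → g x ≡ g y

allPoints : ∀ n → List (Cube n)
allPoints zero    = [ (λ ()) ]
allPoints (suc n) = concatMap (λ x → (false ∷ᵥ x) ∷ (true ∷ᵥ x) ∷ []) (allPoints n)

_==_ : Bool → Bool → Bool
a == b = ⌊ a ≟ b ⌋

flipAt : ∀ {n} → Cube n → Fin n → Cube n
flipAt x i = updateAt x i not

relevant : ∀ {n} → BoolFun n → Fin n → Bool
relevant {n} g i = any (λ x → not (g x == g (flipAt x i))) (allPoints n)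

Coords : ℕ → Set
Coords n = Vector Bool n

size : ∀ {n} → Coords n → ℕ
size {n} S = length (filter (λ i → S i ≟ true) (allFin n))

agreeOn : ∀ {n} → Coords n → Cube n → Cube n → Bool
agreeOn {n} S x y = all (λ i → not (S i) ∨ (y i == x i)) (allFin n)

constOnSubcube : ∀ {n} → BoolFun n → Cube n → Coords n → Bool
constOnSubcube {n} g x S = all (λ y → not (agreeOn S x y) ∨ (g y == g x)) (allPoints n)

-- C_x(g): smallest |S| such that g is constant on the subcube fixed by x on S.
-- (S = [n] always works, so the default value n is never below the true minimum.)
C : ∀ {n} → BoolFun n → Cube n → ℕ
C {n} g x = foldr (λ S acc → if constOnSubcube g x S then size S ⊓ acc else acc) n (allPoints n)

-- C^b_min(g) = min over x with g(x) = b of C_x(g).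
-- (Default n if no such x exists; irrelevant for non-constant g.)
Cmin : ∀ {n} → Bool → BoolFun n → ℕ
Cmin {n} b g = foldr (λ x acc → if g x == b then C g x ⊓ acc else acc) n (allPoints n)

C0min C1min : ∀ {n} → BoolFun n → ℕ
C0min = Cmin false
C1min = Cmin true

commonRelevant : ∀ {n} → BoolFun n → BoolFun n → ℕ
commonRelevant {n} g h = length (filter (λ i → (relevant g i ∧ relevant h i) ≟ true) (allFin n))

-- Monotonicity of f gives f₀ ≤ f₁ pointwise, and each fᵢ depends only on R(fᵢ). With
-- T = R(f₀) ∩ R(f₁), let up B (down B) agree with B ⊆ T on T and be 1 (resp. 0) off T.
-- Then f₀(up B) = f₀(w) ≤ f₁(w) = f₁(down B) for the point w that is B on T, 1 on
-- R(f₀) \ T and 0 on R(f₁) \ T. Along the prefixes ∅ = B₀ ⊆ B₁ ⊆ … ⊆ T, which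
-- grow by one coordinate at a time, f₀(up B₀) = 0 (else f₁ ≡ 1) and f₀(up T) = 1
-- (else f₀ ≡ 0); so for some k, f₀(up Bₖ) = 0 and f₁(down Bₖ₊₁) = 1. By monotonicity
-- the zeros T \ Bₖ of up Bₖ certify f₀ = 0 and the ones Bₖ₊₁ of down Bₖ₊₁ certify
-- f₁ = 1, and |T \ Bₖ| + |Bₖ₊₁| ≤ |T| + 1.
module Submission where

open import Defs
open import Data.Bool.Base using (true; false)
open import Data.Nat.Base using (ℕ; suc; _+_; _≤_)
open import Data.Fin.Base using (Fin)
open import Relation.Nullary using (¬_)

open import Data.Bool.Base using (Bool; not; _∧_; _∨_; if_then_else_; b≤b; f≤t)
  renaming (_≤_ to _≤𝔹_)
import Data.Bool.Properties as 𝔹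
open import Data.Nat.Base using (zero; _⊓_; z≤n; s≤s)
open import Data.Nat.Properties
  using (≤-trans; ≤-reflexive; m⊓n≤m; m⊓n≤n; +-mono-≤; +-monoʳ-≤; +-suc; +-comm;
         module ≤-Reasoning)
open import Data.Fin.Base using (zero; suc)
open import Data.Fin.Properties using (_≟_)
open import Data.List.Base using (List; []; _∷_; filter; length; foldr; tabulate; allFin)
open import Data.List.Membership.Propositional using (_∈_)
open import Data.List.Membership.Propositional.Properties
  using (∈-map⁺; ∈-concat⁺′; ∈-allFin)
open import Data.List.Relation.Unary.Any using (here; there)
open import Data.Bool.ListAction using (all; any)
open import Data.Vec.Functional using (Vector; insertAt; tail) renaming (_∷_ to _∷ᵥ_)
open import Data.Vec.Functional.Properties using (updateAt-updates; updateAt-minimal)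
open import Data.Product.Base using (∃; _×_; _,_)
open import Data.Sum.Base using (_⊎_; inj₁; inj₂)
open import Function.Base using (_∘_)
open import Relation.Binary.Core using (Rel)
open import Relation.Binary.PropositionalEquality
  using (_≡_; _≢_; refl; sym; trans; cong; cong₂; subst; subst₂; module ≡-Reasoning)
open import Relation.Nullary using (yes; no; contradiction)
open import Relation.Nullary.Decidable using (toWitness; fromWitness)
open import Function.Bundles using (Equivalence)

≤𝔹-false : ∀ {a} → a ≤𝔹 false → a ≡ false
≤𝔹-false a≤f = 𝔹.≤-antisym a≤f (𝔹.≤-minimum _)

true-≤𝔹 : ∀ {a} → true ≤𝔹 a → a ≡ true
true-≤𝔹 t≤a = 𝔹.≤-antisym (𝔹.≤-maximum _) t≤a

==⇒≡ : ∀ {a b} → (a == b) ≡ true → a ≡ b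
==⇒≡ e = toWitness (Equivalence.from 𝔹.T-≡ e)

==-refl : ∀ a → (a == a) ≡ true
==-refl a = Equivalence.to 𝔹.T-≡ (fromWitness refl)

not-∨-not : ∀ a b → not (not a ∨ b) ≡ a ∧ not b
not-∨-not true  b = refl
not-∨-not false b = refl

all-intro : ∀ {A : Set} (p : A → Bool) (xs : List A) →
            (∀ x → p x ≡ true) → all p xs ≡ true
all-intro p []       px = refl
all-intro p (x ∷ xs) px rewrite px x = all-intro p xs px

all-elim : ∀ {A : Set} (p : A → Bool) (xs : List A) {x} →
           all p xs ≡ true → x ∈ xs → p x ≡ true
all-elim p (y ∷ xs) e (here refl)  = 𝔹.∧-conicalˡ (p y) _ e
all-elim p (y ∷ xs) e (there x∈xs) = all-elim p xs (𝔹.∧-conicalʳ (p y) _ e) x∈xs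

any-false-elim : ∀ {A : Set} (p : A → Bool) (xs : List A) {x} →
                 any p xs ≡ false → x ∈ xs → p x ≡ false
any-false-elim p (y ∷ xs) e (here refl)  = 𝔹.∨-conicalˡ (p y) _ e
any-false-elim p (y ∷ xs) e (there x∈xs) =
  any-false-elim p xs (𝔹.∨-conicalʳ (p y) _ e) x∈xs

foldr-min-≤ : ∀ {A : Set} (c : A → Bool) (v : A → ℕ) d (xs : List A) {x} →
              x ∈ xs → c x ≡ true →
              foldr (λ y acc → if c y then v y ⊓ acc else acc) d xs ≤ v x
foldr-min-≤ c v d (y ∷ xs) (here refl) cx rewrite cx = m⊓n≤m (v y) _
foldr-min-≤ c v d (y ∷ xs) (there x∈xs) cx with c y
... | true  = ≤-trans (m⊓n≤n (v y) _) (foldr-min-≤ c v d xs x∈xs cx)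
... | false = foldr-min-≤ c v d xs x∈xs cx

rising-edge : ∀ (p : ℕ → Bool) m → p 0 ≡ false → p m ≡ true →
              ∃ λ k → p k ≡ false × p (suc k) ≡ true
rising-edge p zero    p0 pm = contradiction (trans (sym p0) pm) λ ()
rising-edge p (suc m) p0 pm with p m in pm′
... | false = m , pm′ , pm
... | true  = rising-edge p m p0 pm′

bit : Bool → ℕ
bit false = 0
bit true  = 1

count : ∀ {n} → (Fin n → Bool) → ℕ
count {zero}  P = 0
count {suc n} P = bit (P zero) + count (P ∘ suc)

length-filter-tabulate : ∀ {n} {A : Set} (f : Fin n → A) (P : A → Bool) →
                         length (filter (λ a → P a 𝔹.≟ true) (tabulate f)) ≡ count (P ∘ f)
length-filter-tabulate {zero}  f P = refl
length-filter-tabulate {suc n} f P with P (f zero)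
... | true  = cong suc (length-filter-tabulate (f ∘ suc) P)
... | false = length-filter-tabulate (f ∘ suc) P

size≡count : ∀ {n} (S : Coords n) → size S ≡ count S
size≡count S = length-filter-tabulate (λ i → i) S

commonRelevant≡count : ∀ {n} (g h : BoolFun n) →
                       commonRelevant g h ≡ count (λ i → relevant g i ∧ relevant h i)
commonRelevant≡count g h = length-filter-tabulate (λ i → i) (λ i → relevant g i ∧ relevant h i)

count-cong : ∀ {n} {P Q : Fin n → Bool} → (∀ i → P i ≡ Q i) → count P ≡ count Q
count-cong {zero}  P≗Q = refl
count-cong {suc n} P≗Q = cong₂ _+_ (cong bit (P≗Q zero)) (count-cong (P≗Q ∘ suc))

count-false : ∀ {n} {P : Fin n → Bool} → (∀ i → P i ≡ false) → count P ≡ 0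
count-false {zero}  P≗false = refl
count-false {suc n} P≗false rewrite P≗false zero = count-false (P≗false ∘ suc)

count-split : ∀ {n} (P Q : Fin n → Bool) →
              count (λ i → P i ∧ not (Q i)) + count (λ i → P i ∧ Q i) ≡ count P
count-split {zero}  P Q = refl
count-split {suc n} P Q = split (P zero) (Q zero) (count-split (P ∘ suc) (Q ∘ suc))
  where
  split : ∀ p q {x y z} → x + y ≡ z → (bit (p ∧ not q) + x) + (bit (p ∧ q) + y) ≡ bit p + z
  split false q     e = e
  split true  false e = cong suc e
  split true  true  {x} e = trans (+-suc x _) (cong suc e)

prefix : ∀ {n} → ℕ → Coords n
prefix {zero}  k       = λ ()
prefix {suc n} zero    = λ _ → false
prefix {suc n} (suc k) = true ∷ᵥ prefix k

prefix-zero : ∀ {n} (i : Fin n) → prefix 0 i ≡ false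
prefix-zero {suc n} i = refl

prefix-full : ∀ {n} (i : Fin n) → prefix n i ≡ true
prefix-full {suc n} zero    = refl
prefix-full {suc n} (suc i) = prefix-full i

count-prefix-suc : ∀ {n} (P : Fin n → Bool) k →
                   count (λ i → P i ∧ prefix (suc k) i)
                     ≤ suc (count (λ i → P i ∧ prefix k i))
count-prefix-suc {zero}  P k       = z≤n
count-prefix-suc {suc n} P zero    =
  first (P zero ∧ true)
        (count-false (λ i → trans (cong (P (suc i) ∧_) (prefix-zero i)) (𝔹.∧-zeroʳ _)))
  where
  first : ∀ p {x y} → x ≡ 0 → bit p + x ≤ suc y
  first false refl = z≤n
  first true  refl = s≤s z≤n
count-prefix-suc {suc n} P (suc k) =
  ≤-trans (+-monoʳ-≤ (bit (P zero ∧ true)) (count-prefix-suc (P ∘ suc) k))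
          (≤-reflexive (+-suc _ _))

allPoints-complete : ∀ n (x : Cube n) → ∃ λ y → y ∈ allPoints n × (∀ i → y i ≡ x i)
allPoints-complete zero    x = (λ ()) , here refl , λ ()
allPoints-complete (suc n) x with allPoints-complete n (tail x)
... | y , y∈ , y≗ = (x zero ∷ᵥ y) , ∈-concat⁺′ (head∈ (x zero)) (∈-map⁺ _ y∈) , agree
  where
  head∈ : ∀ b → (b ∷ᵥ y) ∈ ((false ∷ᵥ y) ∷ (true ∷ᵥ y) ∷ [])
  head∈ false = here refl
  head∈ true  = there (here refl)
  agree : ∀ i → (x zero ∷ᵥ y) i ≡ x i
  agree zero    = refl
  agree (suc i) = y≗ i

insertAt-pointwise : ∀ {a ℓ} {A : Set a} (R : Rel A ℓ) {m} {xs ys : Vector A m}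
                     (j : Fin (suc m)) → (∀ i → R (xs i) (ys i)) → ∀ {v w} → R v w →
                     ∀ k → R (insertAt xs j v k) (insertAt ys j w k)
insertAt-pointwise R zero xs~ys v~w zero    = v~w
insertAt-pointwise R zero xs~ys v~w (suc k) = xs~ys k
insertAt-pointwise R {suc m} (suc j) xs~ys v~w zero    = xs~ys zero
insertAt-pointwise R {suc m} (suc j) xs~ys v~w (suc k) =
  insertAt-pointwise R j (xs~ys ∘ suc) v~w k

restrict-monotone : ∀ {m} {f : BoolFun (suc m)} j b → Monotone f → Monotone (restrict f j b)
restrict-monotone j b mono x y x≤y = mono _ _ (insertAt-pointwise _≤𝔹_ j x≤y b≤b)

restrict-false≤true : ∀ {m} {f : BoolFun (suc m)} j → Monotone f →
                      ∀ x → restrict f j false x ≤𝔹 restrict f j true x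
restrict-false≤true j mono x = mono _ _ (insertAt-pointwise _≤𝔹_ j (λ _ → 𝔹.≤-refl) f≤t)

-- Without function extensionality, pointwise equal points need not have equal values.
Extensional : ∀ {n} → BoolFun n → Set
Extensional {n} g = ∀ {x y : Cube n} → (∀ i → x i ≡ y i) → g x ≡ g y

monotone⇒extensional : ∀ {n} {g : BoolFun n} → Monotone g → Extensional g
monotone⇒extensional mono {x} {y} x≗y =
  𝔹.≤-antisym (mono x y (𝔹.≤-reflexive ∘ x≗y)) (mono y x (𝔹.≤-reflexive ∘ sym ∘ x≗y))

splice : ∀ {n} → Cube n → Cube n → List (Fin n) → Cube n
splice x y []      i = x i
splice x y (c ∷ L) i with i ≟ c
... | yes _ = y i
... | no  _ = splice x y L i

splice-between : ∀ {n} (x y : Cube n) L i → splice x y L i ≡ x i ⊎ splice x y L i ≡ y i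
splice-between x y []      i = inj₁ refl
splice-between x y (c ∷ L) i with i ≟ c
... | yes _ = inj₂ refl
... | no  _ = splice-between x y L i

splice-∈ : ∀ {n} (x y : Cube n) {L i} → i ∈ L → splice x y L i ≡ y i
splice-∈ x y {c ∷ L} {i} i∈ with i ≟ c
splice-∈ x y {c ∷ L} {i} i∈          | yes _   = refl
splice-∈ x y {c ∷ L} {i} (here i≡c)  | no i≢c  = contradiction i≡c i≢c
splice-∈ x y {c ∷ L} {i} (there i∈L) | no _    = splice-∈ x y i∈L

splice-∷-≢ : ∀ {n} (x y : Cube n) {c L i} → i ≢ c → splice x y (c ∷ L) i ≡ splice x y L i
splice-∷-≢ x y {c} {L} {i} i≢c with i ≟ c
... | yes i≡c = contradiction i≡c i≢c
... | no  _   = refl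

module _ {n} {g : BoolFun n} (ext : Extensional g) where

  flip-irrelevant : ∀ {i y} → relevant g i ≡ false → y ∈ allPoints n → g (flipAt y i) ≡ g y
  flip-irrelevant {i} {y} irr y∈ =
    sym (==⇒≡ (trans (sym (𝔹.not-involutive _)) (cong not unchanged)))
    where
    unchanged : not (g y == g (flipAt y i)) ≡ false
    unchanged = any-false-elim (λ x → not (g x == g (flipAt x i))) (allPoints n) irr y∈

  differ-at-irrelevant : ∀ {c} {z z′ : Cube n} → (∀ i → i ≢ c → z′ i ≡ z i) →
                         (relevant g c ≡ true → z′ c ≡ z c) → g z′ ≡ g z
  differ-at-irrelevant {c} {z} {z′} off at-c with z′ c 𝔹.≟ z c | allPoints-complete n z
  ... | yes same-c | _ = ext same
    where
    same : ∀ i → z′ i ≡ z i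
    same i with i ≟ c
    ... | yes refl = same-c
    ... | no  i≢c  = off i i≢c
  ... | no flipped-c | z₀ , z₀∈ , z₀≗z = begin
      g z′               ≡⟨ ext z′≗flip ⟩
      g (flipAt z₀ c)    ≡⟨ flip-irrelevant (𝔹.¬-not (flipped-c ∘ at-c)) z₀∈ ⟩
      g z₀               ≡⟨ ext z₀≗z ⟩
      g z                ∎
    where
    open ≡-Reasoning
    z′≗flip : ∀ i → z′ i ≡ flipAt z₀ c i
    z′≗flip i with i ≟ c
    ... | yes refl = trans (𝔹.¬-not flipped-c)
                           (trans (cong not (sym (z₀≗z c))) (sym (updateAt-updates c z₀)))
    ... | no  i≢c  = trans (off i i≢c)
                           (trans (sym (z₀≗z i)) (sym (updateAt-minimal i c z₀ i≢c)))

  splice-invariant : ∀ x y → (∀ i → relevant g i ≡ true → x i ≡ y i) →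
                     ∀ L → g (splice x y L) ≡ g x
  splice-invariant x y x≈y []      = refl
  splice-invariant x y x≈y (c ∷ L) =
    trans (differ-at-irrelevant (λ i → splice-∷-≢ x y) at-c) (splice-invariant x y x≈y L)
    where
    at-c : relevant g c ≡ true → splice x y (c ∷ L) c ≡ splice x y L c
    at-c rel with splice-between x y L c
    ... | inj₁ at-x = trans (splice-∈ x y (here refl)) (trans (sym (x≈y c rel)) (sym at-x))
    ... | inj₂ at-y = trans (splice-∈ x y (here refl)) (sym at-y)

  agree-on-relevant : ∀ {x y} → (∀ i → relevant g i ≡ true → x i ≡ y i) → g x ≡ g y
  agree-on-relevant {x} {y} x≈y =
    trans (sym (splice-invariant x y x≈y (allFin n))) (ext (λ i → splice-∈ x y (∈-allFin i)))

≤-across-common : ∀ {n} {g h : BoolFun n} → Extensional g → Extensional h →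
                  (∀ x → g x ≤𝔹 h x) →
                  ∀ {x y} → (∀ i → relevant g i ∧ relevant h i ≡ true → x i ≡ y i) →
                  g x ≤𝔹 h y
≤-across-common {n} {g} {h} ext-g ext-h g≤h {x} {y} common =
  subst₂ _≤𝔹_ (sym (agree-on-relevant ext-g x≈w)) (agree-on-relevant ext-h w≈y) (g≤h w)
  where
  w : Cube n
  w i = if relevant g i then x i else y i
  x≈w : ∀ i → relevant g i ≡ true → x i ≡ w i
  x≈w i rg rewrite rg = refl
  w≈y : ∀ i → relevant h i ≡ true → w i ≡ y i
  w≈y i rh with relevant g i in rg
  ... | true  = common i (trans (cong (_∧ relevant h i) rg) rh)
  ... | false = refl

IsCertificate : ∀ {n} → BoolFun n → Cube n → Coords n → Bool → Set
IsCertificate {n} g x S b = ∀ (y : Cube n) → (∀ i → S i ≡ true → y i ≡ x i) → g y ≡ b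

agreeOn-elim : ∀ {n} {S : Coords n} {x y} → agreeOn S x y ≡ true →
               ∀ i → S i ≡ true → y i ≡ x i
agreeOn-elim {n} {S} {x} {y} agrees i s =
  ==⇒≡ (subst (λ sᵢ → not sᵢ ∨ (y i == x i) ≡ true) s
              (all-elim (λ k → not (S k) ∨ (y k == x k)) (allFin n) agrees (∈-allFin i)))

Cmin≤size : ∀ {n} {g : BoolFun n} {x S b} → IsCertificate g x S b → Cmin b g ≤ size S
Cmin≤size {n} {g} {x} {S} {b} cert with allPoints-complete n x | allPoints-complete n S
... | x′ , x′∈ , x′≗x | S′ , S′∈ , S′≗S = begin
    Cmin b g  ≤⟨ foldr-min-≤ (λ z → g z == b) (C g) n (allPoints n) x′∈ gx′==b ⟩
    C g x′    ≤⟨ foldr-min-≤ (constOnSubcube g x′) size n (allPoints n) S′∈ constant ⟩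
    size S′   ≡⟨ trans (size≡count S′) (trans (count-cong S′≗S) (sym (size≡count S))) ⟩
    size S    ∎
  where
  open ≤-Reasoning
  cert′ : IsCertificate g x′ S′ b
  cert′ y agrees = cert y (λ i s → trans (agrees i (trans (S′≗S i) s)) (x′≗x i))
  gx′≡b : g x′ ≡ b
  gx′≡b = cert′ x′ (λ _ _ → refl)
  gx′==b : (g x′ == b) ≡ true
  gx′==b = subst (λ c → (g x′ == c) ≡ true) gx′≡b (==-refl (g x′))
  constant : constOnSubcube g x′ S′ ≡ true
  constant = all-intro _ (allPoints n) on-subcube
    where
    on-subcube : ∀ y → not (agreeOn S′ x′ y) ∨ (g y == g x′) ≡ true
    on-subcube y with agreeOn S′ x′ y in agrees
    ... | false = refl
    ... | true  = subst (λ c → (c == g x′) ≡ true)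
                        (trans gx′≡b (sym (cert′ y (agreeOn-elim agrees)))) (==-refl (g x′))

zeros-certificate : ∀ {n} {g : BoolFun n} {x} → Monotone g → g x ≡ false →
                    IsCertificate g x (not ∘ x) false
zeros-certificate {g = g} {x} mono gx≡false y agrees =
  ≤𝔹-false (subst (g y ≤𝔹_) gx≡false (mono y x y≤x))
  where
  y≤x : ∀ i → y i ≤𝔹 x i
  y≤x i with x i | agrees i
  ... | true  | _     = 𝔹.≤-maximum (y i)
  ... | false | yᵢ≡xᵢ = 𝔹.≤-reflexive (yᵢ≡xᵢ refl)

ones-certificate : ∀ {n} {g : BoolFun n} {x} → Monotone g → g x ≡ true → IsCertificate g x x true
ones-certificate {g = g} {x} mono gx≡true y agrees =
  true-≤𝔹 (subst (_≤𝔹 g y) gx≡true (mono x y x≤y))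
  where
  x≤y : ∀ i → x i ≤𝔹 y i
  x≤y i with x i | agrees i
  ... | true  | yᵢ≡xᵢ = 𝔹.≤-reflexive (sym (yᵢ≡xᵢ refl))
  ... | false | _     = 𝔹.≤-minimum (y i)

empty-certificate⇒constant : ∀ {n} {g : BoolFun n} {x S b} → IsCertificate g x S b →
                             (∀ i → S i ≡ false) → IsConstant g
empty-certificate⇒constant {x = x} {S} cert S≗false y z =
  trans (cert y vacuous) (sym (cert z vacuous))
  where
  vacuous : ∀ {w : Cube _} i → S i ≡ true → w i ≡ x i
  vacuous i s = contradiction (trans (sym (S≗false i)) s) λ ()

module _ {m} {g h : BoolFun m} (mono-g : Monotone g) (mono-h : Monotone h)
         (g≤h : ∀ x → g x ≤𝔹 h x) where

  private
    common : Coords m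
    common i = relevant g i ∧ relevant h i

    up down : Coords m → Cube m
    up   B i = not (common i) ∨ B i
    down B i = common i ∧ B i

    g-up≤h-down : ∀ B → g (up B) ≤𝔹 h (down B)
    g-up≤h-down B =
      ≤-across-common (monotone⇒extensional mono-g) (monotone⇒extensional mono-h) g≤h on-common
      where
      on-common : ∀ i → common i ≡ true → up B i ≡ down B i
      on-common i c rewrite c = refl

    g-up-true⇒h-down-true : ∀ {B} → g (up B) ≡ true → h (down B) ≡ true
    g-up-true⇒h-down-true {B} e = true-≤𝔹 (subst (_≤𝔹 h (down B)) e (g-up≤h-down B))

    g-up-prefix : ℕ → Bool
    g-up-prefix k = g (up (prefix k))

    starts-false : ¬ IsConstant h → g-up-prefix 0 ≡ false
    starts-false h-nonconstant = 𝔹.¬-not λ at-0 → h-nonconstant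
      (empty-certificate⇒constant (ones-certificate mono-h (g-up-true⇒h-down-true at-0))
        (λ i → trans (cong (common i ∧_) (prefix-zero i)) (𝔹.∧-zeroʳ (common i))))

    ends-true : ¬ IsConstant g → g-up-prefix m ≡ true
    ends-true g-nonconstant = 𝔹.¬-not λ at-m → g-nonconstant
      (empty-certificate⇒constant (zeros-certificate mono-g at-m)
        (λ i → cong not (trans (cong (not (common i) ∨_) (prefix-full i)) (𝔹.∨-zeroʳ _))))

  C0min+C1min≤commonRelevant+1 : ¬ IsConstant g → ¬ IsConstant h →
                                 C0min g + C1min h ≤ commonRelevant g h + 1
  C0min+C1min≤commonRelevant+1 g-nonconstant h-nonconstant
    with rising-edge g-up-prefix m (starts-false h-nonconstant) (ends-true g-nonconstant)
  ... | k , at-k , at-suc-k = begin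
      C0min g + C1min h
        ≤⟨ +-mono-≤ (Cmin≤size (zeros-certificate mono-g at-k))
                    (Cmin≤size (ones-certificate mono-h (g-up-true⇒h-down-true at-suc-k))) ⟩
      size (not ∘ up (prefix k)) + size (down (prefix (suc k)))
        ≡⟨ cong₂ _+_ (trans (size≡count (not ∘ up (prefix k)))
                            (count-cong (λ i → not-∨-not (common i) (prefix k i))))
                     (size≡count (down (prefix (suc k)))) ⟩
      count (λ i → common i ∧ not (prefix k i)) + count (λ i → common i ∧ prefix (suc k) i)
        ≤⟨ +-monoʳ-≤ _ (count-prefix-suc common k) ⟩
      count (λ i → common i ∧ not (prefix k i)) + suc (count (λ i → common i ∧ prefix k i))
        ≡⟨ trans (+-suc _ _) (cong suc (count-split common (prefix k))) ⟩
      suc (count common)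
        ≡⟨ cong suc (sym (commonRelevant≡count g h)) ⟩
      suc (commonRelevant g h)
        ≡⟨ +-comm 1 _ ⟩
      commonRelevant g h + 1 ∎
    where open ≤-Reasoning

lemma8 : ∀ (m : ℕ) (f : BoolFun (suc m)) (j : Fin (suc m)) →
         Monotone f →
         ¬ IsConstant (restrict f j false) →
         ¬ IsConstant (restrict f j true) →
         C0min (restrict f j false) + C1min (restrict f j true)
           ≤ commonRelevant (restrict f j false) (restrict f j true) + 1
lemma8 m f j mono =
  C0min+C1min≤commonRelevant+1 (restrict-monotone j false mono) (restrict-monotone j true mono)
                               (restrict-false≤true j mono)
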